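{- For all positive integers $m,n$ with $m\le n$, $$\chi_o(K_{m,n})=m+\min\{n,2^m\}\quad\text{and}\quad \chi_o^+(K_{m,n})\le m+2^m.$$
   Context: All graphs are finite and simple. An oriented graph is a digraph with no loops, no multiple arcs and no pair of opposite arcs; an orientation of an undirected graph $G$ is obtained by giving each edge one of its two directions. A homomorphism between oriented graphs is a vertex map sending arcs to arcs. The oriented chromatic number $\chi_o(\vec G)$ of an oriented graph $\vec G$ is the smallest order of an oriented graph $\vec T$ with a homomorphism $\vec G\to\vec T$; for an undirected graph $G$, $\chi_o(G)$ is the maximum of $\chi_o(\vec G)$ over all orientations $\vec G$ of $G$. The upper oriented chromatic number $\chi_o^+(G)$ is the smallest order of an oriented graph $\vec T$ such that every orientation of $G$ admits a homomorphism to $\vec T$. $K_{m,n}$ is the complete bipartite graph with parts of sizes $m$ and $n$. -}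

module Defs where

open import Data.Nat using (ℕ; _+_; _^_; _≤_; _<_)
open import Data.Nat.Base using (_⊓_)
open import Data.Fin using (Fin; splitAt)
open import Data.Bool using (Bool; true; false; _xor_)
open import Data.Sum using (_⊎_; inj₁; inj₂)
open import Data.Product using (Σ; _×_; ∃; _,_)
open import Relation.Nullary using (¬_)
open import Relation.Binary.PropositionalEquality using (_≡_; refl)

record Graph (V : ℕ) : Set where
  field
    adj     : Fin V → Fin V → Bool
    adj-sym : ∀ u v → adj u v ≡ adj v u
    adj-irr : ∀ u → adj u u ≡ false
open Graph public

record OGraph (k : ℕ) : Set where
  field
    arc      : Fin k → Fin k → Bool
    arc-irr  : ∀ u → arc u u ≡ false
    arc-asym : ∀ u v → arc u v ≡ true → arc v u ≡ false
open OGraph public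

IsOrientation : ∀ {V} → Graph V → OGraph V → Set
IsOrientation G D =
  (∀ u v → adj G u v ≡ true → (arc D u v ≡ true ⊎ arc D v u ≡ true)) ×
  (∀ u v → arc D u v ≡ true → adj G u v ≡ true)

Hom : ∀ {V k} → OGraph V → OGraph k → Set
Hom {V} {k} D T =
  Σ (Fin V → Fin k) λ f → ∀ u v → arc D u v ≡ true → arc T (f u) (f v) ≡ true

IsOChromatic : ∀ {V} → OGraph V → ℕ → Set
IsOChromatic D c =
  (Σ (OGraph c) λ T → Hom D T) ×
  (∀ j → j < c → (T : OGraph j) → ¬ Hom D T)

IsOChromaticGraph : ∀ {V} → Graph V → ℕ → Set
IsOChromaticGraph G c =
  (∀ D → IsOrientation G D → Σ ℕ λ j → j ≤ c × IsOChromatic D j) ×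
  (Σ (OGraph _) λ D → IsOrientation G D × IsOChromatic D c)

UpperOChromaticAtMost : ∀ {V} → Graph V → ℕ → Set
UpperOChromaticAtMost G c =
  Σ ℕ λ j → j ≤ c × Σ (OGraph j) λ T → ∀ D → IsOrientation G D → Hom D T

-- Complete bipartite graph K_{m,n} on Fin (m + n): first m vertices form one part.
private
  side : ∀ m {n} → Fin (m + n) → Bool
  side m u with splitAt m u
  ... | inj₁ _ = true
  ... | inj₂ _ = false

  xor-comm : ∀ a b → a xor b ≡ b xor a
  xor-comm true true = refl
  xor-comm true false = refl
  xor-comm false true = refl
  xor-comm false false = refl

  xor-self : ∀ a → a xor a ≡ false
  xor-self true = refl
  xor-self false = refl

K : (m n : ℕ) → Graph (m + n)
K m n = record
  { adj = λ u v → side m u xor side m v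
  ; adj-sym = λ u v → xor-comm (side m u) (side m v)
  ; adj-irr = λ u → xor-self (side m u)
  }

-- Every orientation of K_{m,n} maps homomorphically into one fixed orientation
-- of K_{m,2^m}: keep the m-side and send each vertex b of the n-side to the
-- vertex with the same pattern, i.e. the same set of m-side vertices with an
-- arc into b. This gives the bound m + 2^m, and with the trivial bound m + n
-- the upper bound on χ_o. Conversely, give min(n, 2^m) vertices of the n-side
-- pairwise distinct patterns, chosen (using m ≤ n) so that the patterns of m
-- of the n-side vertices separate any two vertices of the m-side. Then any two
-- of these m + min(n, 2^m) vertices are joined by an arc or a directed path of
-- length two, so every homomorphism is injective on them. Since it is
-- decidable whether a homomorphism into an oriented graph of a given order
-- exists, the least such order exists.
module Submission where

open import Defs
open import Data.Bool using (Bool; true; false; not; _xor_)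
open import Data.Bool.Properties
  using (xor-assoc; xor-same; xor-identityʳ; not-injective) renaming (_≟_ to _≟ᵇ_)
open import Data.Empty using (⊥; ⊥-elim)
open import Data.Fin
  using (Fin; zero; suc; toℕ; fromℕ; fromℕ<; inject≤; splitAt; join; _↑ˡ_; _↑ʳ_; combine; remQuot)
open import Data.Fin.Properties
  using (toℕ-injective; toℕ-fromℕ; toℕ-fromℕ<; toℕ-inject; toℕ-inject≤; inject≤-injective;
         toℕ-↑ˡ; toℕ<n; toℕ≤pred[n];
         splitAt-↑ˡ; splitAt-↑ʳ; splitAt-join; join-splitAt; remQuot-combine; combine-remQuot;
         any?; all?; ¬∀⟶∃¬; ¬∀⟶∃¬-smallest; pigeonhole; <⇒≢)
open import Data.Nat using (ℕ; zero; suc; _+_; _^_; _≤_; _<_; _⊓_; z≤n; s≤s; NonZero)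
open import Data.Nat.Properties
  using (≤-refl; <-≤-trans; n<1+n; m<n⇒m<1+n; +-mono-≤; m≤n⇒m≤n+o; m^n>0; m^n≢0;
         ⊓-sel; m⊓n≤m; m⊓n≤n)
  renaming (_≟_ to _≟ℕ_; <⇒≢ to <⇒≢ℕ)
open import Data.Nat.DivMod using (_mod_; m<n⇒m%n≡m)
open import Data.Product using (Σ; ∃; _×_; _,_; proj₁; proj₂; uncurry)
open import Data.Sum using (_⊎_; inj₁; inj₂; map₂)
open import Data.Vec using (Vec; []; _∷_; lookup; tabulate)
open import Data.Vec.Properties using (lookup∘tabulate; tabulate∘lookup; tabulate-cong)
open import Function using (_∘_)
open import Relation.Nullary using (¬_; Dec; yes; no; does; contradiction)
open import Relation.Nullary.Decidable
  using (map′; _⊎-dec_; _×-dec_; _→-dec_; ¬?; decidable-stable; dec-true; dec-false)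
open import Relation.Unary using (Decidable)
open import Relation.Binary.PropositionalEquality
open ≡-Reasoning

-- Exhaustive search

Searchable : Set → Set₁
Searchable A = ∀ {P : A → Set} → Decidable P → Dec (∃ P)

search-Bool : Searchable Bool
search-Bool P? =
  map′ (λ { (inj₁ p) → true , p ; (inj₂ p) → false , p })
       (λ { (true , p) → inj₁ p ; (false , p) → inj₂ p })
       (P? true ⊎-dec P? false)

search-Fin : ∀ {k} → Searchable (Fin k)
search-Fin = any?

search-Vec : ∀ {A} → Searchable A → ∀ k → Searchable (Vec A k)
search-Vec search-A zero P? = map′ ([] ,_) (λ { ([] , p) → p }) (P? [])
search-Vec search-A (suc k) P? =
  map′ (λ { (a , v , p) → a ∷ v , p }) (λ { (a ∷ v , p) → a , v , p })
       (search-A λ a → search-Vec search-A k (P? ∘ (a ∷_)))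

least-≤ : ∀ {Q : ℕ → Set} → Decidable Q → ∀ {c} → Q c →
          ∃ λ j → j ≤ c × Q j × (∀ i → i < j → ¬ Q i)
least-≤ {Q} Q? {c} q
  with ¬∀⟶∃¬-smallest (suc c) (¬_ ∘ Q ∘ toℕ) (¬? ∘ Q? ∘ toℕ)
         (λ none → none (fromℕ c) (subst Q (sym (toℕ-fromℕ c)) q))
... | j , ¬¬q , below =
  toℕ j , toℕ≤pred[n] j , decidable-stable (Q? (toℕ j)) ¬¬q ,
  λ i i<j → below (fromℕ< i<j) ∘ subst Q (sym (trans (toℕ-inject (fromℕ< i<j)) (toℕ-fromℕ< i<j)))

id-Hom : ∀ {V} (D : OGraph V) → Hom D D
id-Hom D = (λ u → u) , (λ u v a → a)

-- The graphs are explicit: Hom unfolds to a Σ-type, from which they cannot be inferred.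
Hom-∘ : ∀ {V W k} (D : OGraph V) (E : OGraph W) (T : OGraph k) → Hom E T → Hom D E → Hom D T
Hom-∘ D E T (g , g-arc) (f , f-arc) = g ∘ f , λ u v a → g-arc (f u) (f v) (f-arc u v a)

hom? : ∀ {V j} (D : OGraph V) (T : OGraph j) → Dec (Hom D T)
hom? {V} {j} D T = map′ (λ { (h , p) → lookup h , p }) fromHom (search-Vec search-Fin V preserves?)
  where
  Preserves : Vec (Fin j) V → Set
  Preserves h = ∀ u v → arc D u v ≡ true → arc T (lookup h u) (lookup h v) ≡ true

  preserves? : Decidable Preserves
  preserves? h = all? λ u → all? λ v →
    (arc D u v ≟ᵇ true) →-dec (arc T (lookup h u) (lookup h v) ≟ᵇ true)

  fromHom : Hom D T → ∃ Preserves
  fromHom (f , f-arc) = tabulate f , λ u v a →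
    subst₂ (λ x y → arc T x y ≡ true) (sym (lookup∘tabulate f u)) (sym (lookup∘tabulate f v))
           (f-arc u v a)

Matrix : ℕ → Set
Matrix j = Vec (Vec Bool j) j

entry : ∀ {j} → Matrix j → Fin j → Fin j → Bool
entry M x y = lookup (lookup M x) y

IsOrientedMatrix : ∀ {j} → Matrix j → Set
IsOrientedMatrix M =
  (∀ x → entry M x x ≡ false) × (∀ x y → entry M x y ≡ true → entry M y x ≡ false)

isOrientedMatrix? : ∀ {j} → Decidable (IsOrientedMatrix {j})
isOrientedMatrix? M =
  (all? λ x → entry M x x ≟ᵇ false) ×-dec
  (all? λ x → all? λ y → (entry M x y ≟ᵇ true) →-dec (entry M y x ≟ᵇ false))

fromMatrix : ∀ {j} (M : Matrix j) → IsOrientedMatrix M → OGraph j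
fromMatrix M o = record { arc = entry M ; arc-irr = proj₁ o ; arc-asym = proj₂ o }

toMatrix : ∀ {j} → OGraph j → Matrix j
toMatrix T = tabulate λ x → tabulate (arc T x)

entry-toMatrix : ∀ {j} (T : OGraph j) x y → entry (toMatrix T) x y ≡ arc T x y
entry-toMatrix T x y =
  trans (cong (λ r → lookup r y) (lookup∘tabulate _ x)) (lookup∘tabulate (arc T x) y)

toMatrix-isOriented : ∀ {j} (T : OGraph j) → IsOrientedMatrix (toMatrix T)
toMatrix-isOriented T =
  (λ x → trans (entry-toMatrix T x x) (arc-irr T x)) ,
  (λ x y a → trans (entry-toMatrix T y x) (arc-asym T x y (trans (sym (entry-toMatrix T x y)) a)))

homInto? : ∀ {V} (D : OGraph V) j → Dec (Σ (OGraph j) (Hom D))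
homInto? D j =
  map′ (λ { (M , o , h) → fromMatrix M o , h })
       (λ { (T , f , f-arc) → toMatrix T , toMatrix-isOriented T ,
                              f , λ u v a → trans (entry-toMatrix T _ _) (f-arc u v a) })
       (search-Vec (search-Vec search-Bool j) j realisable?)
  where
  realisable? : Decidable λ M → Σ (IsOrientedMatrix M) (Hom D ∘ fromMatrix M)
  -- Hom D (fromMatrix M o) does not depend on o: Hom only looks at the arcs.
  realisable? M with isOrientedMatrix? M
  ... | no ¬o = no (¬o ∘ proj₁)
  ... | yes o = map′ (o ,_) proj₂ (hom? D (fromMatrix M o))

oChromatic-≤ : ∀ {V c} (D : OGraph V) → Σ (OGraph c) (Hom D) → Σ ℕ λ j → j ≤ c × IsOChromatic D j
oChromatic-≤ D hom with least-≤ (homInto? D) hom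
... | j , j≤c , hom-j , none = j , j≤c , hom-j , λ i i<j T h → none i i<j (T , h)

-- Oriented cliques

data Linked {V} (D : OGraph V) (u v : Fin V) : Set where
  arc⁺  : arc D u v ≡ true → Linked D u v
  arc⁻  : arc D v u ≡ true → Linked D u v
  path⁺ : ∀ w → arc D u w ≡ true → arc D w v ≡ true → Linked D u v
  path⁻ : ∀ w → arc D v w ≡ true → arc D w u ≡ true → Linked D u v

Linked-sym : ∀ {V} {D : OGraph V} {u v} → Linked D u v → Linked D v u
Linked-sym (arc⁺ a) = arc⁻ a
Linked-sym (arc⁻ a) = arc⁺ a
Linked-sym (path⁺ w a b) = path⁻ w a b
Linked-sym (path⁻ w a b) = path⁺ w a b

arc⇒≢ : ∀ {j} (T : OGraph j) {x y} → arc T x y ≡ true → x ≢ y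
arc⇒≢ T {x} a refl = contradiction (trans (sym (arc-irr T x)) a) λ ()

arc⇒¬arc : ∀ {j} (T : OGraph j) {x y} → arc T x y ≡ true → arc T y x ≡ true → ⊥
arc⇒¬arc T {x} {y} a b = contradiction (trans (sym (arc-asym T x y a)) b) λ ()

Hom-separates-Linked : ∀ {V j} {D : OGraph V} {T : OGraph j} (h : Hom D T) {u v} →
                       Linked D u v → proj₁ h u ≢ proj₁ h v
Hom-separates-Linked {T = T} (f , f-arc) (arc⁺ a) = arc⇒≢ T (f-arc _ _ a)
Hom-separates-Linked {T = T} (f , f-arc) (arc⁻ a) = arc⇒≢ T (f-arc _ _ a) ∘ sym
Hom-separates-Linked {T = T} (f , f-arc) (path⁺ w a b) fu≡fv =
  arc⇒¬arc T (f-arc _ w a) (subst (λ x → arc T (f w) x ≡ true) (sym fu≡fv) (f-arc w _ b))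
Hom-separates-Linked {T = T} (f , f-arc) (path⁻ w a b) fu≡fv =
  arc⇒¬arc T (f-arc _ w a) (subst (λ x → arc T (f w) x ≡ true) fu≡fv (f-arc w _ b))

oclique-bound : ∀ {V c} {D : OGraph V} (g : Fin c → Fin V) → (∀ x y → x ≢ y → Linked D (g x) (g y)) →
                ∀ j → j < c → (T : OGraph j) → ¬ Hom D T
oclique-bound g linked j j<c T (f , f-arc) with pigeonhole j<c (f ∘ g)
... | x , y , x<y , fx≡fy = Hom-separates-Linked {T = T} (f , f-arc) (linked x y (<⇒≢ x<y)) fx≡fy

isLeft : ∀ {A B : Set} → A ⊎ B → Bool
isLeft (inj₁ _) = true
isLeft (inj₂ _) = false

adj-K : ∀ m n u v → adj (K m n) u v ≡ isLeft (splitAt m {n} u) xor isLeft (splitAt m v)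
adj-K m n u v with splitAt m u | splitAt m v
... | inj₁ _ | inj₁ _ = refl
... | inj₁ _ | inj₂ _ = refl
... | inj₂ _ | inj₁ _ = refl
... | inj₂ _ | inj₂ _ = refl

adj-K-join : ∀ m n s t → adj (K m n) (join m n s) (join m n t) ≡ isLeft s xor isLeft t
adj-K-join m n s t = trans (adj-K m n _ _)
  (cong₂ (λ s′ t′ → isLeft s′ xor isLeft t′) (splitAt-join m n s) (splitAt-join m n t))

module _ {m n : ℕ} (d : Fin n → Vec Bool m) where

  bipArc : Fin m ⊎ Fin n → Fin m ⊎ Fin n → Bool
  bipArc (inj₁ i) (inj₂ k) = lookup (d k) i
  bipArc (inj₂ k) (inj₁ i) = not (lookup (d k) i)
  bipArc (inj₁ _) (inj₁ _) = false
  bipArc (inj₂ _) (inj₂ _) = false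

  bipArc-irr : ∀ s → bipArc s s ≡ false
  bipArc-irr (inj₁ _) = refl
  bipArc-irr (inj₂ _) = refl

  bipArc-asym : ∀ s t → bipArc s t ≡ true → bipArc t s ≡ false
  bipArc-asym (inj₁ i) (inj₂ k) a = cong not a
  bipArc-asym (inj₂ k) (inj₁ i) a = not-injective {y = false} a

  bipArc-crossing : ∀ s t → isLeft s xor isLeft t ≡ true → bipArc s t ≡ true ⊎ bipArc t s ≡ true
  bipArc-crossing (inj₁ i) (inj₂ k) _ with lookup (d k) i
  ... | true  = inj₁ refl
  ... | false = inj₂ refl
  bipArc-crossing (inj₂ k) (inj₁ i) _ with lookup (d k) i
  ... | true  = inj₂ refl
  ... | false = inj₁ refl

  bipArc-crosses : ∀ s t → bipArc s t ≡ true → isLeft s xor isLeft t ≡ true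
  bipArc-crosses (inj₁ i) (inj₂ k) _ = refl
  bipArc-crosses (inj₂ k) (inj₁ i) _ = refl

orientK : ∀ m n → (Fin n → Vec Bool m) → OGraph (m + n)
orientK m n d = record
  { arc      = λ u v → bipArc d (splitAt m u) (splitAt m v)
  ; arc-irr  = λ u → bipArc-irr d (splitAt m u)
  ; arc-asym = λ u v → bipArc-asym d (splitAt m u) (splitAt m v)
  }

orientK-isOrientation : ∀ m n d → IsOrientation (K m n) (orientK m n d)
orientK-isOrientation m n d =
  (λ u v e → bipArc-crossing d (splitAt m u) (splitAt m v) (trans (sym (adj-K m n u v)) e)) ,
  (λ u v a → trans (adj-K m n u v) (bipArc-crosses d (splitAt m u) (splitAt m v) a))

profile : ∀ {m n} → OGraph (m + n) → Fin n → Vec Bool m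
profile {m} {n} D k = tabulate λ i → arc D (i ↑ˡ n) (m ↑ʳ k)

profile-bipArc : ∀ {m n} {D : OGraph (m + n)} → IsOrientation (K m n) D → ∀ s t →
                 arc D (join m n s) (join m n t) ≡ true → bipArc (profile D) s t ≡ true
profile-bipArc o (inj₁ i) (inj₂ k) a = trans (lookup∘tabulate _ i) a
profile-bipArc {D = D} o (inj₂ k) (inj₁ i) a = cong not (trans (lookup∘tabulate _ i) (arc-asym D _ _ a))
profile-bipArc {m} {n} o s@(inj₁ _) t@(inj₁ _) a =
  contradiction (trans (sym (adj-K-join m n s t)) (proj₂ o _ _ a)) λ ()
profile-bipArc {m} {n} o s@(inj₂ _) t@(inj₂ _) a =
  contradiction (trans (sym (adj-K-join m n s t)) (proj₂ o _ _ a)) λ ()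

orientation-into-profile : ∀ m n (D : OGraph (m + n)) → IsOrientation (K m n) D →
                           Hom D (orientK m n (profile D))
orientation-into-profile m n D o = (λ u → u) , λ u v a →
  profile-bipArc {D = D} o (splitAt m u) (splitAt m v)
    (subst₂ (λ x y → arc D x y ≡ true) (sym (join-splitAt m n u)) (sym (join-splitAt m n v)) a)

bipArc-relabel : ∀ {m n N} {d : Fin n → Vec Bool m} {e : Fin N → Vec Bool m} (φ : Fin n → Fin N) →
                 (∀ k → e (φ k) ≡ d k) → ∀ s t → bipArc e (map₂ φ s) (map₂ φ t) ≡ bipArc d s t
bipArc-relabel φ e∘φ≡d (inj₁ i) (inj₂ k) = cong (λ r → lookup r i) (e∘φ≡d k)
bipArc-relabel φ e∘φ≡d (inj₂ k) (inj₁ i) = cong (λ r → not (lookup r i)) (e∘φ≡d k)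
bipArc-relabel φ e∘φ≡d (inj₁ _) (inj₁ _) = refl
bipArc-relabel φ e∘φ≡d (inj₂ _) (inj₂ _) = refl

orientK-relabel : ∀ {m n N} {d : Fin n → Vec Bool m} {e : Fin N → Vec Bool m} (φ : Fin n → Fin N) →
                  (∀ k → e (φ k) ≡ d k) → Hom (orientK m n d) (orientK m N e)
orientK-relabel {m} {n} {N} {d} {e} φ e∘φ≡d = relabel , λ u v a → begin
  bipArc e (splitAt m (relabel u)) (splitAt m (relabel v))
    ≡⟨ cong₂ (bipArc e) (splitAt-join m N (map₂ φ (splitAt m u)))
                        (splitAt-join m N (map₂ φ (splitAt m v))) ⟩
  bipArc e (map₂ φ (splitAt m u)) (map₂ φ (splitAt m v))
    ≡⟨ bipArc-relabel φ e∘φ≡d (splitAt m u) (splitAt m v) ⟩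
  bipArc d (splitAt m u) (splitAt m v)
    ≡⟨ a ⟩
  true ∎
  where
  relabel : Fin (m + n) → Fin (m + N)
  relabel = join m N ∘ map₂ φ ∘ splitAt m

module _ {m n : ℕ} (d : Fin n → Vec Bool m) where

  private
    D = orientK m n d

  orientK-↑ˡ↑ʳ : ∀ i k → arc D (i ↑ˡ n) (m ↑ʳ k) ≡ lookup (d k) i
  orientK-↑ˡ↑ʳ i k rewrite splitAt-↑ˡ m i n | splitAt-↑ʳ m n k = refl

  orientK-↑ʳ↑ˡ : ∀ i k → arc D (m ↑ʳ k) (i ↑ˡ n) ≡ not (lookup (d k) i)
  orientK-↑ʳ↑ˡ i k rewrite splitAt-↑ˡ m i n | splitAt-↑ʳ m n k = refl

  Linked-↑ˡ↑ʳ : ∀ i k → Linked D (i ↑ˡ n) (m ↑ʳ k)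
  Linked-↑ˡ↑ʳ i k with lookup (d k) i in p
  ... | true  = arc⁺ (trans (orientK-↑ˡ↑ʳ i k) p)
  ... | false = arc⁻ (trans (orientK-↑ʳ↑ˡ i k) (cong not p))

  Linked-↑ˡ↑ˡ : ∀ {i i′} k → lookup (d k) i ≢ lookup (d k) i′ → Linked D (i ↑ˡ n) (i′ ↑ˡ n)
  Linked-↑ˡ↑ˡ {i} {i′} k differ with lookup (d k) i in p | lookup (d k) i′ in q
  ... | true  | true  = ⊥-elim (differ refl)
  ... | false | false = ⊥-elim (differ refl)
  ... | true  | false =
    path⁺ (m ↑ʳ k) (trans (orientK-↑ˡ↑ʳ i k) p) (trans (orientK-↑ʳ↑ˡ i′ k) (cong not q))
  ... | false | true  =
    path⁻ (m ↑ʳ k) (trans (orientK-↑ˡ↑ʳ i′ k) q) (trans (orientK-↑ʳ↑ˡ i k) (cong not p))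

  Linked-↑ʳ↑ʳ : ∀ {k k′} i → lookup (d k) i ≢ lookup (d k′) i → Linked D (m ↑ʳ k) (m ↑ʳ k′)
  Linked-↑ʳ↑ʳ {k} {k′} i differ with lookup (d k) i in p | lookup (d k′) i in q
  ... | true  | true  = ⊥-elim (differ refl)
  ... | false | false = ⊥-elim (differ refl)
  ... | true  | false =
    path⁻ (i ↑ˡ n) (trans (orientK-↑ʳ↑ˡ i k′) (cong not q)) (trans (orientK-↑ˡ↑ʳ i k) p)
  ... | false | true  =
    path⁺ (i ↑ˡ n) (trans (orientK-↑ʳ↑ˡ i k) (cong not p)) (trans (orientK-↑ˡ↑ʳ i k′) q)

-- Enumerating the patterns

toBool : Fin 2 → Bool
toBool zero       = false
toBool (suc zero) = true

fromBool : Bool → Fin 2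
fromBool false = zero
fromBool true  = suc zero

toBool-fromBool : ∀ b → toBool (fromBool b) ≡ b
toBool-fromBool false = refl
toBool-fromBool true  = refl

fromBool-toBool : ∀ b → fromBool (toBool b) ≡ b
fromBool-toBool zero       = refl
fromBool-toBool (suc zero) = refl

xor-cancelʳ : ∀ x y → (x xor y) xor y ≡ x
xor-cancelʳ x y = trans (xor-assoc x y y) (trans (cong (x xor_) (xor-same y)) (xor-identityʳ x))

n<2^n : ∀ n → n < 2 ^ n
n<2^n zero    = s≤s z≤n
n<2^n (suc n) = +-mono-≤ (m^n>0 2 n) (m≤n⇒m≤n+o 0 (n<2^n n))

marked : ∀ m → Fin (2 ^ m) → Bool
marked m a = does (toℕ a ≟ℕ m)

-- Binary notation of the index, most significant bit first, except that at
-- length m + 1 the leading bit is flipped when the remaining bits encode m.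
-- The flip makes every coordinate true in one of the first m patterns
-- (enum-covers), and hence lets these patterns separate any two coordinates.
enum : ∀ m → Fin (2 ^ m) → Vec Bool m
enum zero    _ = []
enum (suc m) x = uncurry (λ b a → (toBool b xor marked m a) ∷ enum m a) (remQuot {2} (2 ^ m) x)

enum⁻¹ : ∀ m → Vec Bool m → Fin (2 ^ m)
enum⁻¹ zero    []      = zero
enum⁻¹ (suc m) (b ∷ v) = let a = enum⁻¹ m v in combine (fromBool (b xor marked m a)) a

enum-combine : ∀ m (b : Fin 2) (a : Fin (2 ^ m)) →
               enum (suc m) (combine b a) ≡ (toBool b xor marked m a) ∷ enum m a
enum-combine m b a = cong (uncurry λ b a → (toBool b xor marked m a) ∷ enum m a) (remQuot-combine {2} b a)

enum-enum⁻¹ : ∀ m v → enum m (enum⁻¹ m v) ≡ v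
enum-enum⁻¹ zero    []      = refl
enum-enum⁻¹ (suc m) (b ∷ v) = begin
  enum (suc m) (combine (fromBool (b xor c)) a)
    ≡⟨ enum-combine m (fromBool (b xor c)) a ⟩
  (toBool (fromBool (b xor c)) xor c) ∷ enum m a
    ≡⟨ cong (λ b′ → (b′ xor c) ∷ enum m a) (toBool-fromBool (b xor c)) ⟩
  ((b xor c) xor c) ∷ enum m a
    ≡⟨ cong₂ _∷_ (xor-cancelʳ b c) (enum-enum⁻¹ m v) ⟩
  b ∷ v ∎
  where
  a = enum⁻¹ m v
  c = marked m a

enum⁻¹-enum : ∀ m x → enum⁻¹ m (enum m x) ≡ x
enum⁻¹-enum zero    zero = refl
enum⁻¹-enum (suc m) x = begin
  enum⁻¹ (suc m) (enum (suc m) x)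
    ≡⟨ cong (enum⁻¹ (suc m) ∘ enum (suc m)) (combine-remQuot {2} (2 ^ m) x) ⟨
  enum⁻¹ (suc m) (enum (suc m) (uncurry combine (remQuot {2} (2 ^ m) x)))
    ≡⟨ uncurry on-combine (remQuot {2} (2 ^ m) x) ⟩
  uncurry combine (remQuot {2} (2 ^ m) x)
    ≡⟨ combine-remQuot {2} (2 ^ m) x ⟩
  x ∎
  where
  on-combine : ∀ b a → enum⁻¹ (suc m) (enum (suc m) (combine b a)) ≡ combine b a
  on-combine b a = begin
    enum⁻¹ (suc m) (enum (suc m) (combine b a))
      ≡⟨ cong (enum⁻¹ (suc m)) (enum-combine m b a) ⟩
    combine (fromBool ((toBool b xor c) xor marked m (enum⁻¹ m (enum m a)))) (enum⁻¹ m (enum m a))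
      ≡⟨ cong (λ a′ → combine (fromBool ((toBool b xor c) xor marked m a′)) a′) (enum⁻¹-enum m a) ⟩
    combine (fromBool ((toBool b xor c) xor c)) a
      ≡⟨ cong (λ b′ → combine (fromBool b′) a) (xor-cancelʳ (toBool b) c) ⟩
    combine (fromBool (toBool b)) a
      ≡⟨ cong (λ b′ → combine b′ a) (fromBool-toBool b) ⟩
    combine b a ∎
    where
    c = marked m a

enum-injective : ∀ m {x y} → enum m x ≡ enum m y → x ≡ y
enum-injective m {x} {y} eq = begin
  x                  ≡⟨ enum⁻¹-enum m x ⟨
  enum⁻¹ m (enum m x) ≡⟨ cong (enum⁻¹ m) eq ⟩
  enum⁻¹ m (enum m y) ≡⟨ enum⁻¹-enum m y ⟩
  y                  ∎

enum-combine-zero : ∀ m a → enum (suc m) (combine {2} zero a) ≡ marked m a ∷ enum m a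
enum-combine-zero m = enum-combine m zero

combine-zero-< : ∀ {m} (a : Fin (2 ^ m)) → toℕ a < m → toℕ (combine {2} zero a) < suc m
combine-zero-< a a<m = m<n⇒m<1+n (subst (_< _) (sym (toℕ-↑ˡ a _)) a<m)

enum-covers : ∀ m (i : Fin m) → ∃ λ (a : Fin (2 ^ m)) → toℕ a < m × lookup (enum m a) i ≡ true
enum-covers (suc m) zero = combine {2} zero a , a<suc-m , is-marked
  where
  a = fromℕ< (n<2^n m)
  a<suc-m : toℕ (combine {2} zero a) < suc m
  a<suc-m = subst (_< suc m) (sym (trans (toℕ-↑ˡ a _) (toℕ-fromℕ< _))) (n<1+n m)
  is-marked : lookup (enum (suc m) (combine {2} zero a)) zero ≡ true
  is-marked = trans (cong (λ r → lookup r zero) (enum-combine-zero m a))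
                    (dec-true (toℕ a ≟ℕ m) (toℕ-fromℕ< _))
enum-covers (suc m) (suc i) with enum-covers m i
... | a , a<m , covered = combine {2} zero a , combine-zero-< a a<m ,
  trans (cong (λ r → lookup r (suc i)) (enum-combine-zero m a)) covered

enum-separates : ∀ m {i j : Fin m} → i ≢ j →
                 ∃ λ (a : Fin (2 ^ m)) → toℕ a < m × lookup (enum m a) i ≢ lookup (enum m a) j
enum-separates (suc m) {zero}  {zero}  i≢j = ⊥-elim (i≢j refl)
enum-separates (suc m) {zero}  {suc j} _   with enum-covers m j
... | a , a<m , covered = combine {2} zero a , combine-zero-< a a<m ,
  subst (λ r → lookup r zero ≢ lookup r (suc j)) (sym (enum-combine-zero m a))
    λ eq → contradiction (trans (sym (dec-false (toℕ a ≟ℕ m) (<⇒≢ℕ a<m))) (trans eq covered)) λ ()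
enum-separates (suc m) {suc i} {zero}  _   with enum-separates (suc m) {zero} {suc i} (λ ())
... | a , a<m , differ = a , a<m , differ ∘ sym
enum-separates (suc m) {suc i} {suc j} i≢j with enum-separates m (i≢j ∘ cong suc)
... | a , a<m , differ = combine {2} zero a , combine-zero-< a a<m ,
  subst (λ r → lookup r (suc i) ≢ lookup r (suc j)) (sym (enum-combine-zero m a)) differ

universal : ∀ m → OGraph (m + 2 ^ m)
universal m = orientK m (2 ^ m) (enum m)

orientation-into-universal : ∀ m n (D : OGraph (m + n)) → IsOrientation (K m n) D → Hom D (universal m)
orientation-into-universal m n D o =
  Hom-∘ D (orientK m n (profile D)) (universal m)
    (orientK-relabel (enum⁻¹ m ∘ profile D) (enum-enum⁻¹ m ∘ profile D))
    (orientation-into-profile m n D o)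

orientation-hom-bound : ∀ m n (D : OGraph (m + n)) → IsOrientation (K m n) D →
                        Σ (OGraph (m + (n ⊓ 2 ^ m))) (Hom D)
orientation-hom-bound m n D o with n ⊓ 2 ^ m | ⊓-sel n (2 ^ m)
... | _ | inj₁ refl = D , id-Hom D
... | _ | inj₂ refl = universal m , orientation-into-universal m n D o

lookup-≢ : ∀ {k} {xs ys : Vec Bool k} → xs ≢ ys → ∃ λ i → lookup xs i ≢ lookup ys i
lookup-≢ {k} {xs} {ys} xs≢ys = ¬∀⟶∃¬ k _ (λ i → lookup xs i ≟ᵇ lookup ys i) λ pointwise →
  xs≢ys (trans (sym (tabulate∘lookup xs)) (trans (tabulate-cong pointwise) (tabulate∘lookup ys)))

toℕ-mod : ∀ {a d} .{{_ : NonZero d}} → a < d → toℕ (a mod d) ≡ a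
toℕ-mod a<d = trans (toℕ-fromℕ< _) (m<n⇒m%n≡m a<d)

module Extremal (m n : ℕ) where

  private instance
    2^m≢0 : NonZero (2 ^ m)
    2^m≢0 = m^n≢0 2 m

  cyclicPattern : Fin n → Vec Bool m
  cyclicPattern k = enum m (toℕ k mod 2 ^ m)

  extremal : OGraph (m + n)
  extremal = orientK m n cyclicPattern

  cyclicPattern-small : ∀ k (a : Fin (2 ^ m)) → toℕ k ≡ toℕ a → cyclicPattern k ≡ enum m a
  cyclicPattern-small k a k≡a =
    cong (enum m) (toℕ-injective (trans (toℕ-mod (subst (_< 2 ^ m) (sym k≡a) (toℕ<n a))) k≡a))

  member : Fin m ⊎ Fin (n ⊓ 2 ^ m) → Fin (m + n)
  member = join m n ∘ map₂ (λ k → inject≤ k (m⊓n≤m n (2 ^ m)))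

  cyclicPattern-member : ∀ k → cyclicPattern (inject≤ k (m⊓n≤m n (2 ^ m)))
                             ≡ enum m (inject≤ k (m⊓n≤n n (2 ^ m)))
  cyclicPattern-member k = cyclicPattern-small _ _ (trans (toℕ-inject≤ k _) (sym (toℕ-inject≤ k _)))

  members-Linked : m ≤ n → ∀ s t → s ≢ t → Linked extremal (member s) (member t)
  members-Linked m≤n (inj₁ i) (inj₁ i′) s≢t with enum-separates m (s≢t ∘ cong inj₁)
  ... | a , a<m , differ = Linked-↑ˡ↑ˡ cyclicPattern k
    (subst (λ r → lookup r i ≢ lookup r i′) (sym (cyclicPattern-small k a (toℕ-fromℕ< _))) differ)
    where k = fromℕ< (<-≤-trans a<m m≤n)
  members-Linked m≤n (inj₁ i) (inj₂ k) _ = Linked-↑ˡ↑ʳ cyclicPattern i _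
  members-Linked m≤n (inj₂ k) (inj₁ i) _ = Linked-sym (Linked-↑ˡ↑ʳ cyclicPattern i _)
  members-Linked m≤n (inj₂ k) (inj₂ k′) s≢t with lookup-≢ patterns-differ
    where
    patterns-differ : cyclicPattern (inject≤ k _) ≢ cyclicPattern (inject≤ k′ _)
    patterns-differ eq = s≢t (cong inj₂ (inject≤-injective _ _ k k′ (enum-injective m
      (trans (sym (cyclicPattern-member k)) (trans eq (cyclicPattern-member k′))))))
  ... | i , differ = Linked-↑ʳ↑ʳ cyclicPattern i differ

  extremal-isOChromatic : m ≤ n → IsOChromatic extremal (m + (n ⊓ 2 ^ m))
  extremal-isOChromatic m≤n =
    orientation-hom-bound m n extremal (orientK-isOrientation m n cyclicPattern) ,
    oclique-bound (member ∘ splitAt m)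
      λ x y x≢y → members-Linked m≤n _ _ (x≢y ∘ splitAt-injective x y)
    where
    splitAt-injective : ∀ x y → splitAt m x ≡ splitAt m y → x ≡ y
    splitAt-injective x y eq =
      trans (sym (join-splitAt m _ x)) (trans (cong (join m _) eq) (join-splitAt m _ y))

open Extremal using (extremal; cyclicPattern; extremal-isOChromatic)

theorem2 : ∀ (m n : ℕ) → 1 ≤ m → m ≤ n →
    IsOChromaticGraph (K m n) (m + (n ⊓ 2 ^ m)) × UpperOChromaticAtMost (K m n) (m + 2 ^ m)
theorem2 m n _ m≤n =
  ( (λ D o → oChromatic-≤ D (orientation-hom-bound m n D o))
  , extremal m n , orientK-isOrientation m n (cyclicPattern m n) , extremal-isOChromatic m n m≤n )
  , (m + 2 ^ m , ≤-refl , universal m , orientation-into-universal m n)
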